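{- Let $G$ be a graph with distinguished vertices $s\neq r$, and let $A$ be a protocol for $G$. Then there is a partial forwarding protocol (PFP) $A'$ for $G$ with the following properties: (a) the edge-set of every $A$-walk contains (the edges of) an $A'$-path; (b) the edge-set of every $A'$-walk contains an $A'$-path; (c) every instruction in $A'$ is contained in some $A'$-path (so $A'$ is strongly essential); (d) if $A$ is finite, then $A'$ is finite.
   Context: All graphs are finite, undirected and simple, with two distinct distinguished vertices $s$ (sender) and $r$ (receiver). An instruction is a triple $uvw$ where $u,w$ are distinct neighbors of $v$ ($uvw$ and $wvu$ are different instructions). A protocol is a set of instructions. A $u,v$-walk of length $k$ is a sequence $v_0,\dots,v_k$ of vertices with $v_0=u$, $v_k=v$ and $v_{i-1}v_i$ an edge for $1\le i\le k$; it contains the instruction $uvw$ if $u=v_{i-1},v=v_i,w=v_{i+1}$ for some $i$. A path is a walk with all vertices distinct. For a protocol $A$, an $A$-walk (resp. $A$-path) is an $s,r$-walk (resp. $s,r$-path) every instruction of which belongs to $A$. A protocol $A$ is finite if there are only finitely many $A$-walks. An instruction is strongly essential for $A$ if it is contained in some $A$-path. The complete forwarding protocol (CFP) $A^*$ is the set of all instructions contained in some $s,r$-path of $G$; a partial forwarding protocol (PFP) is a protocol $A\subseteq A^*$. -}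

module Defs where

open import Data.Nat using (ℕ)
open import Data.Fin using (Fin)
open import Data.Bool using (Bool; true)
open import Data.Empty using (⊥)
open import Data.List using (List; []; _∷_)
open import Data.List.Relation.Unary.All using (All)
open import Data.List.Relation.Unary.Unique.Propositional using (Unique)
open import Data.List.Membership.Propositional using (_∈_)
open import Data.Product using (Σ; ∃; _×_; _,_; proj₁; proj₂)
open import Data.Sum using (_⊎_)
open import Relation.Binary.PropositionalEquality using (_≡_; _≢_)

record Graph (n : ℕ) : Set where
  field
    adj     : Fin n → Fin n → Bool
    adj-sym : ∀ u v → adj u v ≡ true → adj v u ≡ true
    irrefl  : ∀ v → adj v v ≡ true → ⊥

open Graph public

Vertex : ℕ → Set
Vertex n = Fin n

Protocol : ℕ → Set
Protocol n = Fin n → Fin n → Fin n → Bool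

IsInstruction : ∀ {n} → Graph n → Fin n → Fin n → Fin n → Set
IsInstruction G u v w = (adj G u v ≡ true) × (adj G v w ≡ true) × (u ≢ w)

IsProtocol : ∀ {n} → Graph n → Protocol n → Set
IsProtocol G A = ∀ u v w → A u v w ≡ true → IsInstruction G u v w

pairs : ∀ {a} {X : Set a} → List X → List (X × X)
pairs []           = []
pairs (x ∷ [])     = []
pairs (x ∷ y ∷ xs) = (x , y) ∷ pairs (y ∷ xs)

triples : ∀ {a} {X : Set a} → List X → List (X × X × X)
triples []               = []
triples (x ∷ [])         = []
triples (x ∷ y ∷ [])     = []
triples (x ∷ y ∷ z ∷ xs) = (x , y , z) ∷ triples (y ∷ z ∷ xs)

lastOf : ∀ {a} {X : Set a} → X → List X → X
lastOf x []       = x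
lastOf x (y ∷ ys) = lastOf y ys

IsWalk : ∀ {n} → Graph n → Fin n → Fin n → List (Fin n) → Set
IsWalk {n} G u v ws =
  Σ (List (Fin n)) (λ ys → (ws ≡ u ∷ ys) × (lastOf u ys ≡ v))
  × All (λ e → adj G (proj₁ e) (proj₂ e) ≡ true) (pairs ws)

ContainsInstr : ∀ {n} → List (Fin n) → Fin n → Fin n → Fin n → Set
ContainsInstr ws u v w = (u , v , w) ∈ triples ws

IsPath : ∀ {n} → Graph n → Fin n → Fin n → List (Fin n) → Set
IsPath G u v ws = IsWalk G u v ws × Unique ws

IsAWalk : ∀ {n} → Graph n → (s r : Fin n) → Protocol n → List (Fin n) → Set
IsAWalk G s r A ws = IsWalk G s r ws × All (λ t → A (proj₁ t) (proj₁ (proj₂ t)) (proj₂ (proj₂ t)) ≡ true) (triples ws)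

IsAPath : ∀ {n} → Graph n → (s r : Fin n) → Protocol n → List (Fin n) → Set
IsAPath G s r A ws = IsAWalk G s r A ws × Unique ws

-- A is finite: there are only finitely many A-walks
-- (all of them occur in some finite list).
FiniteProtocol : ∀ {n} → Graph n → (s r : Fin n) → Protocol n → Set
FiniteProtocol {n} G s r A =
  Σ (List (List (Fin n))) (λ L → ∀ ws → IsAWalk G s r A ws → ws ∈ L)

InCFP : ∀ {n} → Graph n → (s r : Fin n) → Fin n → Fin n → Fin n → Set
InCFP {n} G s r u v w = Σ (List (Fin n)) (λ ps → IsPath G s r ps × ContainsInstr ps u v w)

IsPFP : ∀ {n} → Graph n → (s r : Fin n) → Protocol n → Set
IsPFP G s r A = ∀ u v w → A u v w ≡ true → InCFP G s r u v w

EdgeOf : ∀ {n} → Fin n → Fin n → List (Fin n) → Set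
EdgeOf a b ws = ((a , b) ∈ pairs ws) ⊎ ((b , a) ∈ pairs ws)

EdgesContain : ∀ {n} → List (Fin n) → List (Fin n) → Set
EdgesContain ws ps = ∀ a b → (a , b) ∈ pairs ps → EdgeOf a b ws

ContainsAPath : ∀ {n} → Graph n → (s r : Fin n) → Protocol n → List (Fin n) → Set
ContainsAPath {n} G s r A ws = Σ (List (Fin n)) (λ ps → IsAPath G s r A ps × EdgesContain ws ps)

-- Call an instruction uvw linked (for A) if a packet arriving along the arc uv can be carried by A onto
-- the arc vw, i.e. vw is reachable from uv in the digraph on arcs whose steps are the instructions of A.
-- Take A′ to be the instructions lying on s,r-paths all of whose instructions are linked. Instructions
-- of A and of A′ are linked. In a linked walk the first arc reaches every later arc, so erasing loops
-- (from the end backwards) keeps it linked and yields a linked path on its own edges: this is an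
-- A′-path, giving (a), (b) and (c). Conversely each linked instruction unfolds into a segment of an
-- A-walk, so every A′-walk is a subsequence of an A-walk, which gives (d). Linkedness is decidable since
-- the arc digraph is finite, and linked paths have length at most n, so A′ is computable.

module Submission where

open import Defs
open import Data.Nat using (ℕ; zero; suc; _+_; _≤_; s≤s)
open import Data.Nat.Properties using (≤-trans; m≤m+n; +-suc; n≮n)
open import Data.Fin using (Fin) renaming (_≟_ to _≟ᶠ_)
open import Data.Fin.Properties using (injective⇒≤)
open import Data.Bool using (true) renaming (_≟_ to _≟ᵇ_)
open import Data.List
  using (List; []; _∷_; _++_; map; concatMap; cartesianProduct; cartesianProductWith; length; lookup; allFin)
open import Data.List.Properties using (length-tabulate)
open import Data.List.Relation.Unary.Any using (here; there; any?; satisfied; index)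
open import Data.List.Relation.Unary.Any.Properties using (lookup-index)
open import Data.List.Relation.Unary.All as All using (All; []; _∷_; all?)
open import Data.List.Relation.Unary.All.Properties using (¬Any⇒All¬)
open import Data.List.Relation.Unary.AllPairs using ([]; _∷_)
open import Data.List.Relation.Unary.Unique.Propositional using (Unique)
open import Data.List.Membership.Propositional using (_∈_; _∉_; lose)
open import Data.List.Membership.Propositional.Properties
  using ( ∈-lookup; ∈-map⁺; ∈-++⁺ˡ; ∈-++⁺ʳ; ∈-concatMap⁺
        ; ∈-cartesianProductWith⁺; ∈-cartesianProduct⁺; ∈-allFin)
open import Data.List.Relation.Binary.Subset.Propositional using (_⊆_)
open import Data.List.Relation.Binary.Sublist.Propositional using ([]; _∷_; _∷ʳ_) renaming (_⊆_ to _⊑_)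
open import Data.List.Relation.Binary.Sublist.Propositional.Properties using (++⁺ˡ)
open import Data.Product using (Σ; ∃; _×_; _,_; proj₁; proj₂; uncurry)
open import Data.Product.Properties using (≡-dec)
open import Data.Sum using (_⊎_; inj₁; inj₂)
open import Function using (_∘_)
open import Level using (0ℓ)
open import Relation.Nullary using (Dec; yes; no; does; contradiction)
open import Relation.Nullary.Decidable using (map′; _×-dec_; dec-true)
open import Relation.Binary using (Rel; Decidable; DecidableEquality)
open import Relation.Binary.PropositionalEquality using (_≡_; _≢_; refl; sym; trans; cong; subst)
open import Relation.Binary.Construct.Closure.Transitive using (TransClosure; [_]; _∷_) renaming (_++_ to _++⁺_)

private variable
  X : Set
  x y : X
  xs ys : List X

Unique⇒lookup-injective : Unique xs → ∀ {i j} → lookup xs i ≡ lookup xs j → i ≡ j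
Unique⇒lookup-injective (_ ∷ _) {Fin.zero} {Fin.zero} _ = refl
Unique⇒lookup-injective (x∉ ∷ _) {Fin.zero} {Fin.suc j} eq = contradiction eq (All.lookup x∉ (∈-lookup j))
Unique⇒lookup-injective (x∉ ∷ _) {Fin.suc i} {Fin.zero} eq = contradiction (sym eq) (All.lookup x∉ (∈-lookup i))
Unique⇒lookup-injective (_ ∷ u) {Fin.suc i} {Fin.suc j} eq = cong Fin.suc (Unique⇒lookup-injective u eq)

Unique-⊆⇒length≤ : Unique xs → xs ⊆ ys → length xs ≤ length ys
Unique-⊆⇒length≤ {xs = xs} {ys} u xs⊆ys = injective⇒≤ position-injective
  where
    position : Fin (length xs) → Fin (length ys)
    position i = index (xs⊆ys (∈-lookup i))

    position-correct : ∀ i → lookup xs i ≡ lookup ys (position i)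
    position-correct i = lookup-index (xs⊆ys (∈-lookup i))

    position-injective : ∀ {i j} → position i ≡ position j → i ≡ j
    position-injective {i} {j} eq = Unique⇒lookup-injective u
      (trans (position-correct i) (trans (cong (lookup ys) eq) (sym (position-correct j))))

Unique⇒length≤ : ∀ {n} {xs : List (Fin n)} → Unique xs → length xs ≤ n
Unique⇒length≤ {n} {xs} u =
  subst (length xs ≤_) (length-tabulate {n = n} (λ i → i)) (Unique-⊆⇒length≤ u (λ {i} _ → ∈-allFin i))

sublists : List X → List (List X)
sublists [] = [] ∷ []
sublists (x ∷ xs) = sublists xs ++ map (x ∷_) (sublists xs)

∈-sublists : xs ⊑ ys → xs ∈ sublists ys
∈-sublists [] = here refl
∈-sublists (y ∷ʳ xs⊑ys) = ∈-++⁺ˡ (∈-sublists xs⊑ys)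
∈-sublists {ys = y ∷ ys} (refl ∷ xs⊑ys) = ∈-++⁺ʳ (sublists ys) (∈-map⁺ (y ∷_) (∈-sublists xs⊑ys))

listsOfLength≤ : List X → ℕ → List (List X)
listsOfLength≤ xs zero = [] ∷ []
listsOfLength≤ xs (suc k) = [] ∷ cartesianProductWith _∷_ xs (listsOfLength≤ xs k)

∈-listsOfLength≤ : ∀ {k} → All (_∈ xs) ys → length ys ≤ k → ys ∈ listsOfLength≤ xs k
∈-listsOfLength≤ {k = zero} [] _ = here refl
∈-listsOfLength≤ {k = suc k} [] _ = here refl
∈-listsOfLength≤ {k = suc k} (y∈ ∷ ys∈) (s≤s len) =
  there (∈-cartesianProductWith⁺ _∷_ y∈ (∈-listsOfLength≤ ys∈ len))

∉-∷ : ∀ {a} → x ≢ a → x ∉ xs → x ∉ a ∷ xs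
∉-∷ x≢a _ (here x≡a) = x≢a x≡a
∉-∷ _ x∉xs (there x∈xs) = x∉xs x∈xs

does-true⇒ : ∀ {P : Set} (p? : Dec P) → does p? ≡ true → P
does-true⇒ (yes p) _ = p

lastOf-++ : ∀ (h : X) (xs : List X) y ys → lastOf h (xs ++ y ∷ ys) ≡ lastOf y ys
lastOf-++ h [] y ys = refl
lastOf-++ h (x ∷ xs) y ys = lastOf-++ x xs y ys

pairs-∷ : ∀ (x : X) (xs : List X) → pairs xs ⊆ pairs (x ∷ xs)
pairs-∷ x (y ∷ z ∷ xs) e∈ = there e∈

triples-∷ : ∀ (x : X) (xs : List X) → triples xs ⊆ triples (x ∷ xs)
triples-∷ x (y ∷ z ∷ w ∷ xs) t∈ = there t∈

suffixAfter : {x : X} {xs : List X} → x ∈ xs → List X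
suffixAfter {xs = _ ∷ xs} (here _) = xs
suffixAfter (there x∈xs) = suffixAfter x∈xs

lastOf-suffixAfter : (x∈ : x ∈ y ∷ ys) → lastOf x (suffixAfter x∈) ≡ lastOf y ys
lastOf-suffixAfter (here refl) = refl
lastOf-suffixAfter {ys = _ ∷ _} (there x∈) = lastOf-suffixAfter x∈

pairs-suffixAfter : (x∈ : x ∈ xs) → pairs (x ∷ suffixAfter x∈) ⊆ pairs xs
pairs-suffixAfter (here refl) e∈ = e∈
pairs-suffixAfter {xs = y ∷ ys} (there x∈) e∈ = pairs-∷ y ys (pairs-suffixAfter x∈ e∈)

triples-suffixAfter : (x∈ : x ∈ xs) → triples (x ∷ suffixAfter x∈) ⊆ triples xs
triples-suffixAfter (here refl) t∈ = t∈
triples-suffixAfter {xs = y ∷ ys} (there x∈) t∈ = triples-∷ y ys (triples-suffixAfter x∈ t∈)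

Unique-suffixAfter : Unique xs → (x∈ : x ∈ xs) → Unique (x ∷ suffixAfter x∈)
Unique-suffixAfter u (here refl) = u
Unique-suffixAfter (_ ∷ u) (there x∈) = Unique-suffixAfter u x∈

module FiniteTransClosure {X : Set} (_≟_ : DecidableEquality X)
  (elems : List X) (∈-elems : ∀ x → x ∈ elems)
  {_∼_ : Rel X 0ℓ} (_∼?_ : Decidable _∼_) where

  open import Data.List.Membership.DecPropositional _≟_ using (_∈?_)

  data Avoiding (S : List X) : X → X → Set where
    stop : ∀ {x} → x ∉ S → Avoiding S x x
    step : ∀ {x y z} → x ∉ S → x ∼ y → Avoiding S y z → Avoiding S x z

  start∉ : ∀ {S x z} → Avoiding S x z → x ∉ S
  start∉ (stop x∉S) = x∉S
  start∉ (step x∉S _ _) = x∉S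

  forget : ∀ {S a x z} → Avoiding (a ∷ S) x z → Avoiding S x z
  forget (stop x∉) = stop (x∉ ∘ there)
  forget (step x∉ x∼y c) = step (x∉ ∘ there) x∼y (forget c)

  Exit : List X → X → X → Set
  Exit S x z = ∃ λ y → x ∼ y × Avoiding (x ∷ S) y z

  exit : ∀ {S x z} → x ∉ S → Exit S x z → Avoiding S x z
  exit x∉S (_ , x∼y , c) = step x∉S x∼y (forget c)

  -- Either the chain never visits a, or its part after the last visit to a avoids a.
  cutAtLastVisit : ∀ {S x z} a → Avoiding S x z → Avoiding (a ∷ S) x z ⊎ (a ≡ z ⊎ Exit S a z)
  cutAtLastVisit {x = x} a (stop x∉S) with x ≟ a
  ... | yes refl = inj₂ (inj₁ refl)
  ... | no x≢a = inj₁ (stop (∉-∷ x≢a x∉S))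
  cutAtLastVisit {x = x} a (step x∉S x∼y c) with cutAtLastVisit a c
  ... | inj₂ later = inj₂ later
  ... | inj₁ c′ with x ≟ a
  ...   | yes refl = inj₂ (inj₂ (_ , x∼y , c′))
  ...   | no x≢a = inj₁ (step (∉-∷ x≢a x∉S) x∼y c′)

  leaveForGood : ∀ {S x z} → x ≢ z → Avoiding S x z → Exit S x z
  leaveForGood {x = x} x≢z c with cutAtLastVisit x c
  ... | inj₁ c′ = contradiction (here refl) (start∉ c′)
  ... | inj₂ (inj₁ x≡z) = contradiction x≡z x≢z
  ... | inj₂ (inj₂ leave) = leave

  -- The fuel k bounds the number of elements outside S, the only ones a chain may still visit.
  avoiding? : ∀ k S → Unique S → length elems ≤ k + length S → ∀ x z → Dec (Avoiding S x z)
  leaving? : ∀ k S {x z} → Unique (x ∷ S) → length elems ≤ k + length S → x ∉ S → x ≢ z →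
             Dec (Avoiding S x z)

  avoiding? k S u bound x z with x ∈? S | x ≟ z
  ... | yes x∈S | _ = no λ c → start∉ c x∈S
  ... | no x∉S | yes refl = yes (stop x∉S)
  ... | no x∉S | no x≢z = leaving? k S (¬Any⇒All¬ S x∉S ∷ u) bound x∉S x≢z

  leaving? zero S fresh bound _ _ =
    contradiction (≤-trans (Unique-⊆⇒length≤ fresh (λ {y} _ → ∈-elems y)) bound) (n≮n _)
  leaving? (suc k) S {x} {z} fresh bound x∉S x≢z =
    map′ (exit x∉S ∘ satisfied) (λ c → let y , leave = leaveForGood x≢z c in lose (∈-elems y) leave)
         (any? (λ y → (x ∼? y) ×-dec avoiding? k (x ∷ S) fresh bound′ y z) elems)
    where
      bound′ : length elems ≤ k + length (x ∷ S)
      bound′ = subst (length elems ≤_) (sym (+-suc k (length S))) bound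

  toTransClosure : ∀ {S x y z} → x ∼ y → Avoiding S y z → TransClosure _∼_ x z
  toTransClosure x∼y (stop _) = [ x∼y ]
  toTransClosure x∼y (step _ y∼y′ c) = x∼y ∷ toTransClosure y∼y′ c

  fromTransClosure : ∀ {x z} → TransClosure _∼_ x z → ∃ λ y → x ∼ y × Avoiding [] y z
  fromTransClosure [ x∼z ] = _ , x∼z , stop λ ()
  fromTransClosure (x∼y ∷ c) = let _ , y∼y′ , c′ = fromTransClosure c in _ , x∼y , step (λ ()) y∼y′ c′

  transClosure? : Decidable (TransClosure _∼_)
  transClosure? x z =
    map′ (uncurry toTransClosure ∘ proj₂ ∘ satisfied)
         (λ c → let y , first = fromTransClosure c in lose (∈-elems y) first)
         (any? (λ y → (x ∼? y) ×-dec avoiding? (length elems) [] [] (m≤m+n _ 0) y z) elems)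

module Linking {X : Set} (_≟_ : DecidableEquality X) (_↝_ : Rel (X × X) 0ℓ) where

  open import Data.List.Membership.DecPropositional _≟_ using (_∈?_)

  Linked : X × X × X → Set
  Linked (u , v , w) = TransClosure _↝_ (u , v) (v , w)

  LinkedWalk : List X → Set
  LinkedWalk ws = All Linked (triples ws)

  LinkedWalk-tail : ∀ x ws → LinkedWalk (x ∷ ws) → LinkedWalk ws
  LinkedWalk-tail x [] _ = []
  LinkedWalk-tail x (_ ∷ []) _ = []
  LinkedWalk-tail x (_ ∷ _ ∷ _) (_ ∷ linked) = linked

  firstArc-reaches : ∀ {x y} ws → LinkedWalk (x ∷ y ∷ ws) → ∀ {e} → e ∈ pairs (y ∷ ws) →
                     TransClosure _↝_ (x , y) e
  firstArc-reaches (z ∷ ws) (xyz ∷ _) (here refl) = xyz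
  firstArc-reaches (z ∷ ws) (xyz ∷ linked) (there e∈) = xyz ++⁺ firstArc-reaches ws linked e∈

  record LoopErasure (x : X) (ws : List X) : Set where
    field
      path       : List X
      unique     : Unique (x ∷ path)
      same-last  : lastOf x path ≡ lastOf x ws
      arcs⊆      : pairs (x ∷ path) ⊆ pairs (x ∷ ws)
      linked     : LinkedWalk (x ∷ path)

  -- The first arc xy reaches every arc of y ∷ ws, in particular the first arc of y ∷ ps.
  prepend-linked : ∀ {x y ws} ps → LinkedWalk (x ∷ y ∷ ws) → pairs (y ∷ ps) ⊆ pairs (y ∷ ws) →
                   LinkedWalk (y ∷ ps) → LinkedWalk (x ∷ y ∷ ps)
  prepend-linked [] _ _ _ = []
  prepend-linked {ws = ws} (p ∷ ps) linked arcs⊆ linked′ =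
    firstArc-reaches ws linked (arcs⊆ (here refl)) ∷ linked′

  loopErasure : ∀ x ws → LinkedWalk (x ∷ ws) → LoopErasure x ws
  loopErasure x [] _ =
    record { path = [] ; unique = [] ∷ [] ; same-last = refl ; arcs⊆ = λ () ; linked = [] }
  loopErasure x (y ∷ ws) linkedWalk with loopErasure y ws (LinkedWalk-tail x (y ∷ ws) linkedWalk)
  ... | e with x ∈? (y ∷ LoopErasure.path e)
  ... | no x∉ = record
    { path = y ∷ path
    ; unique = ¬Any⇒All¬ _ x∉ ∷ unique
    ; same-last = same-last
    ; arcs⊆ = λ { (here refl) → here refl ; (there e∈) → there (arcs⊆ e∈) }
    ; linked = prepend-linked path linkedWalk arcs⊆ linked
    }
    where open LoopErasure e
  ... | yes x∈ = record
    { path = suffixAfter x∈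
    ; unique = Unique-suffixAfter unique x∈
    ; same-last = trans (lastOf-suffixAfter x∈) same-last
    ; arcs⊆ = pairs-∷ x (y ∷ ws) ∘ arcs⊆ ∘ pairs-suffixAfter x∈
    ; linked = All.tabulate (All.lookup linked ∘ triples-suffixAfter x∈)
    }
    where open LoopErasure e

Adjacent : ∀ {n} → Graph n → List (Fin n) → Set
Adjacent G ws = All (λ e → adj G (proj₁ e) (proj₂ e) ≡ true) (pairs ws)

Obeys : ∀ {n} → Protocol n → List (Fin n) → Set
Obeys A ws = All (λ t → A (proj₁ t) (proj₁ (proj₂ t)) (proj₂ (proj₂ t)) ≡ true) (triples ws)

isWalk? : ∀ {n} (G : Graph n) u v → (ws : List (Fin n)) → Dec (IsWalk G u v ws)
isWalk? G u v [] = no λ { ((_ , () , _) , _) }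
isWalk? G u v (x ∷ ys)
  with x ≟ᶠ u | lastOf x ys ≟ᶠ v | all? (λ e → adj G (proj₁ e) (proj₂ e) ≟ᵇ true) (pairs (x ∷ ys))
... | yes refl | yes last | yes adjacent = yes ((ys , refl , last) , adjacent)
... | no x≢u | _ | _ = no λ { ((_ , refl , _) , _) → x≢u refl }
... | yes refl | no ¬last | _ = no λ { ((_ , refl , last) , _) → ¬last last }
... | yes refl | yes _ | no ¬adjacent = no (¬adjacent ∘ proj₂)

module ProtocolWalks {n} (G : Graph n) (A : Protocol n) (A-instr : IsProtocol G A) where

  data _↝_ : Rel (Fin n × Fin n) 0ℓ where
    follow : ∀ {u v w} → A u v w ≡ true → (u , v) ↝ (v , w)

  _↝?_ : Decidable _↝_
  (u , v) ↝? (v′ , w) with v ≟ᶠ v′ | A u v w ≟ᵇ true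
  ... | yes refl | yes α = yes (follow α)
  ... | no v≢v′ | _ = no λ { (follow _) → v≢v′ refl }
  ... | yes refl | no ¬α = no λ { (follow α) → ¬α α }

  open Linking _≟ᶠ_ _↝_ public

  open FiniteTransClosure (≡-dec _≟ᶠ_ _≟ᶠ_) (cartesianProduct (allFin n) (allFin n))
    (λ (u , v) → ∈-cartesianProduct⁺ (∈-allFin u) (∈-allFin v)) _↝?_ using (transClosure?)

  linked? : ∀ t → Dec (Linked t)
  linked? (u , v , w) = transClosure? (u , v) (v , w)

  Conforms : List (Fin n) → Set
  Conforms ws = Adjacent G ws × Obeys A ws

  Obeys⇒LinkedWalk : ∀ {ws} → Obeys A ws → LinkedWalk ws
  Obeys⇒LinkedWalk = All.map λ α → [ follow α ]

  prepend : ∀ {u v w ws} → A u v w ≡ true → Conforms (v ∷ w ∷ ws) → Conforms (u ∷ v ∷ w ∷ ws)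
  prepend α (adjacent , obeys) = proj₁ (A-instr _ _ _ α) ∷ adjacent , α ∷ obeys

  extend : ∀ {a b c d ws} → TransClosure _↝_ (a , b) (c , d) → Conforms (c ∷ d ∷ ws) →
           ∃ λ mid → Conforms (a ∷ b ∷ mid ++ d ∷ ws)
  extend [ follow α ] conforms = [] , prepend α conforms
  extend (follow α ∷ chain) conforms =
    let mid , conforms′ = extend chain conforms in _ ∷ mid , prepend α conforms′

  expand : ∀ x y ws → LinkedWalk (x ∷ y ∷ ws) → Adjacent G (x ∷ y ∷ ws) →
           ∃ λ ws′ → Conforms (x ∷ y ∷ ws′) × ws ⊑ ws′ × lastOf y ws′ ≡ lastOf y ws
  expand x y [] _ adjacent = [] , (adjacent , []) , [] , refl
  expand x y (z ∷ ws) (xyz ∷ linked) (_ ∷ adjacent) with expand y z ws linked adjacent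
  ... | ws′ , conforms , ws⊑ws′ , last with extend xyz conforms
  ...   | mid , conforms′ =
          mid ++ z ∷ ws′ , conforms′ , ++⁺ˡ mid (refl ∷ ws⊑ws′) , trans (lastOf-++ y mid z ws′) last

module Construction {n} (G : Graph n) (s r : Fin n) (A : Protocol n) (A-instr : IsProtocol G A) where

  open ProtocolWalks G A A-instr public

  open import Data.List.Membership.DecPropositional (≡-dec (_≟ᶠ_ {n}) (≡-dec (_≟ᶠ_ {n}) (_≟ᶠ_ {n})))
    using (_∈?_)
  open import Data.List.Relation.Unary.Unique.DecPropositional (_≟ᶠ_ {n}) using (unique?)

  LinkedPath : List (Fin n) → Set
  LinkedPath ps = IsPath G s r ps × LinkedWalk ps

  OnLinkedPath : Fin n × Fin n × Fin n → Set
  OnLinkedPath t = ∃ λ ps → LinkedPath ps × t ∈ triples ps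

  linkedPath? : ∀ ps → Dec (LinkedPath ps)
  linkedPath? ps = (isWalk? G s r ps ×-dec unique? ps) ×-dec all? linked? (triples ps)

  onLinkedPath? : ∀ t → Dec (OnLinkedPath t)
  onLinkedPath? t =
    map′ satisfied (λ (ps , linkedPath , t∈) → lose (candidate linkedPath) (linkedPath , t∈))
         (any? (λ ps → linkedPath? ps ×-dec t ∈? triples ps) (listsOfLength≤ (allFin n) n))
    where
      candidate : ∀ {ps} → LinkedPath ps → ps ∈ listsOfLength≤ (allFin n) n
      candidate ((_ , unique) , _) =
        ∈-listsOfLength≤ (All.tabulate λ {v} _ → ∈-allFin v) (Unique⇒length≤ unique)

  A′ : Protocol n
  A′ u v w = does (onLinkedPath? (u , v , w))

  A′-sound : ∀ {u v w} → A′ u v w ≡ true → OnLinkedPath (u , v , w)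
  A′-sound = does-true⇒ (onLinkedPath? _)

  LinkedPath⇒A′-path : ∀ {ps} → LinkedPath ps → IsAPath G s r A′ ps
  LinkedPath⇒A′-path linkedPath@((walk , unique) , _) =
    (walk , All.tabulate λ t∈ → dec-true (onLinkedPath? _) (_ , linkedPath , t∈)) , unique

  Obeys-A′⇒LinkedWalk : ∀ {ws} → Obeys A′ ws → LinkedWalk ws
  Obeys-A′⇒LinkedWalk = All.map λ h → let _ , (_ , linked) , t∈ = A′-sound h in All.lookup linked t∈

  containsA′-path : ∀ {ws} → IsWalk G s r ws → LinkedWalk ws → ContainsAPath G s r A′ ws
  containsA′-path ((ys , refl , last) , adjacent) linkedWalk =
    s ∷ path , LinkedPath⇒A′-path (walk , linked) , λ _ _ e∈ → inj₁ (arcs⊆ e∈)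
    where
      open LoopErasure (loopErasure s ys linkedWalk)
      walk : IsPath G s r (s ∷ path)
      walk = ((path , refl , trans same-last last) , All.tabulate (All.lookup adjacent ∘ arcs⊆)) , unique

  A′-PFP : IsPFP G s r A′
  A′-PFP u v w h = let ps , (path , _) , t∈ = A′-sound h in ps , path , t∈

  A′-stronglyEssential : ∀ u v w → A′ u v w ≡ true →
                         Σ (List (Fin n)) (λ ps → IsAPath G s r A′ ps × ContainsInstr ps u v w)
  A′-stronglyEssential u v w h =
    let ps , linkedPath , t∈ = A′-sound h in ps , LinkedPath⇒A′-path linkedPath , t∈

  -- Each A′-walk is a subsequence of an A-walk, namely its expansion.
  A′-finite : s ≢ r → FiniteProtocol G s r A → FiniteProtocol G s r A′
  A′-finite s≢r (walks , complete) = concatMap sublists walks , listed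
    where
      listed : ∀ ws → IsAWalk G s r A′ ws → ws ∈ concatMap sublists walks
      listed _ (((ys , refl , last) , adjacent) , obeys) with ys
      ... | [] = contradiction last s≢r
      ... | y ∷ ws with expand s y ws (Obeys-A′⇒LinkedWalk obeys) adjacent
      ...   | ws′ , (adjacent′ , obeys′) , ws⊑ws′ , last′ =
              ∈-concatMap⁺ sublists (lose (complete _ expansion) (∈-sublists (refl ∷ refl ∷ ws⊑ws′)))
        where
          expansion : IsAWalk G s r A (s ∷ y ∷ ws′)
          expansion = ((y ∷ ws′ , refl , trans last′ last) , adjacent′) , obeys′

lemma2p2 : ∀ {n} (G : Graph n) (s r : Fin n) → s ≢ r →
    (A : Protocol n) → IsProtocol G A →
    Σ (Protocol n) (λ A' →
      IsPFP G s r A'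
      × (∀ ws → IsAWalk G s r A ws → ContainsAPath G s r A' ws)
      × (∀ ws → IsAWalk G s r A' ws → ContainsAPath G s r A' ws)
      × (∀ u v w → A' u v w ≡ true →
           Σ (List (Fin n)) (λ ps → IsAPath G s r A' ps × ContainsInstr ps u v w))
      × (FiniteProtocol G s r A → FiniteProtocol G s r A'))
lemma2p2 G s r s≢r A A-instr =
  A′ , A′-PFP
     , (λ _ (walk , obeys) → containsA′-path walk (Obeys⇒LinkedWalk obeys))
     , (λ _ (walk , obeys) → containsA′-path walk (Obeys-A′⇒LinkedWalk obeys))
     , A′-stronglyEssential
     , A′-finite s≢r
  where open Construction G s r A A-instr
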